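{- For every $n\ge 1$, the number of permutations of $\{1,\dots,n\}$ whose Schröder insertion tableau consists of a single row is $2^{\lfloor n/2\rfloor}$.
   Context: A (partial) Schröder tableau is stored as a sequence of rows; row $r$ is a sequence of cells at positions $1,2,\dots,\ell_r$, each containing a number; the cell at an odd position is an upper triangle and at an even position a lower triangle. Schröder insertion of a number $\alpha$ into a tableau $P$: set $i=1$ and repeat: if row $i$ does not exist or $\alpha$ exceeds every entry of row $i$, append a new cell containing $\alpha$ at the end of row $i$ (creating the row if needed) and stop. Otherwise let $j$ be the position in row $i$ of the smallest entry $\gamma>\alpha$. If $j$ is even, write $\alpha$ at position $j$, set $\alpha:=\gamma$, $i:=i+1$ and repeat. If $j$ is odd and is the last position of row $i$, write $\alpha$ at position $j$, append a new cell at position $j+1$ containing $\gamma$, and stop. If $j$ is odd and not last, let $\beta$ be the entry at position $j+1$; write $\alpha$ at $j$ and $\gamma$ at $j+1$, set $\alpha:=\beta$, $i:=i+1$ and repeat. The Schröder insertion tableau of $\pi=\pi_1\cdots\pi_n$ is obtained by starting from the one-cell tableau containing $\pi_1$ and successively inserting $\pi_2,\dots,\pi_n$. -}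

module Defs where

open import Data.Nat using (ℕ; zero; suc; _<ᵇ_; _≡ᵇ_)
open import Data.Bool using (Bool; true; false; if_then_else_)
open import Data.List using (List; []; _∷_; _++_; [_]; length; foldl; applyUpTo)
open import Data.Maybe using (Maybe; just; nothing)
open import Data.Product using (_×_; _,_)

-- A (partial) Schröder tableau: list of rows, each row a list of entries;
-- the cell at 0-based index k is at position k+1 (odd position = upper triangle).
Row : Set
Row = List ℕ

Tableau : Set
Tableau = List Row

evenIdx : ℕ → Bool
evenIdx zero = true
evenIdx (suc zero) = false
evenIdx (suc (suc k)) = evenIdx k

-- entry at 0-based index (default 0 if out of range; never used out of range)
at : ℕ → Row → ℕ
at _ [] = 0
at zero (x ∷ _) = x
at (suc k) (_ ∷ xs) = at k xs

setAt : ℕ → ℕ → Row → Row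
setAt _ _ [] = []
setAt zero a (_ ∷ xs) = a ∷ xs
setAt (suc k) a (x ∷ xs) = x ∷ setAt k a xs

minAboveFrom : ℕ → ℕ → Row → Maybe (ℕ × ℕ) → Maybe (ℕ × ℕ)
minAboveFrom α i [] best = best
minAboveFrom α i (x ∷ xs) nothing =
  minAboveFrom α (suc i) xs (if α <ᵇ x then just (i , x) else nothing)
minAboveFrom α i (x ∷ xs) (just (j , g)) =
  minAboveFrom α (suc i) xs
    (if (α <ᵇ x) Data.Bool.∧ (x <ᵇ g) then just (i , x) else just (j , g))

minAbove : ℕ → Row → Maybe (ℕ × ℕ)
minAbove α row = minAboveFrom α 0 row nothing

-- One step of Schröder insertion of α into a row: the new row, and
-- 'just α′' if α′ must be inserted into the next row, 'nothing' if we stop.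
rowStep : ℕ → Row → Row × Maybe ℕ
rowStep α row with minAbove α row
... | nothing = row ++ [ α ] , nothing
... | just (k , γ) with evenIdx k
...   | false = setAt k α row , just γ
...   | true with suc k ≡ᵇ length row
...     | true  = setAt k α row ++ [ γ ] , nothing
...     | false = setAt (suc k) γ (setAt k α row) , just (at (suc k) row)

insert : ℕ → Tableau → Tableau
insert α [] = [ [ α ] ]
insert α (r ∷ rs) with rowStep α r
... | r′ , nothing = r′ ∷ rs
... | r′ , just α′ = r′ ∷ insert α′ rs

insertionTableau : List ℕ → Tableau
insertionTableau [] = []
insertionTableau (x ∷ xs) = foldl (λ P a → insert a P) [ [ x ] ] xs

oneToN : ℕ → List ℕ
oneToN n = applyUpTo suc n

-- Inserting the letters of a permutation keeps the tableau a single row only if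
-- each inserted letter either exceeds everything inserted so far (and is
-- appended) or is the second largest letter so far while the largest sits in an
-- upper triangle (then the two trade places and nothing is bumped).  Reading
-- the permutation backwards, this means it arises from 1 2 ⋯ n by independently
-- swapping or not each of the pairs (1 2), (3 4), …, which gives 2 ^ ⌊n/2⌋
-- choices.

module Submission where

open import Defs
open import Data.Nat using (ℕ; _≥_; _^_; _/_)
open import Data.List using (List; length)
open import Data.List.Membership.Propositional using (_∈_)
open import Data.List.Relation.Unary.Unique.Propositional using (Unique)
open import Data.List.Relation.Binary.Permutation.Propositional using (_↭_)
open import Data.Product using (Σ; _×_)
open import Function.Bundles using (_⇔_)
open import Relation.Binary.PropositionalEquality using (_≡_)

open import Data.Nat using (suc; _<_; _≤_; _+_; _<ᵇ_; _≡ᵇ_; s≤s; z≤n)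
open import Data.Nat.Properties using (<⇒<ᵇ; <ᵇ⇒<; <⇒≤; ≤⇒≯; <⇒≢; <-trans; +-suc; +-identityʳ)
open import Data.Nat.DivMod using (m/n≡1+[m∸n]/n)
open import Data.Bool using (true; false; T)
open import Data.Bool.Properties using (T-≡)
open import Data.List using ([]; _∷_; _++_; _∷ʳ_; [_]; null; map; foldl)
open import Data.List.Properties
  using (++-identityʳ; ++-assoc; foldl-∷ʳ; length-++; length-map; length-applyUpTo; ∷-injectiveˡ; ∷-injectiveʳ)
open import Data.List.Reverse using (Reverse; []; _∶_∶ʳ_; reverseView)
open import Data.List.Relation.Unary.All using (All; []; _∷_)
import Data.List.Relation.Unary.All as All
import Data.List.Relation.Unary.All.Properties as All
open import Data.List.Relation.Unary.AllPairs using (AllPairs; []; _∷_)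
import Data.List.Relation.Unary.AllPairs as AllPairs
import Data.List.Relation.Unary.AllPairs.Properties as AllPairs
open import Data.List.Relation.Unary.Any using (here)
open import Data.List.Membership.Propositional.Properties using (∈-map⁺; ∈-map⁻; ∈-++⁻; ∈-++⁺ˡ; ∈-++⁺ʳ; ∈-∃++)
import Data.List.Relation.Binary.Permutation.Propositional as Perm
open import Data.List.Relation.Binary.Permutation.Propositional.Properties using (∈-resp-↭; drop-mid; ↭-empty-inv)
import Data.List.Relation.Unary.Unique.Propositional.Properties as Unique
open import Data.Maybe using (just; nothing)
open import Data.Product using (_,_; proj₁; proj₂; ∃)
open import Data.Empty using (⊥)
open import Data.Sum using (_⊎_; inj₁; inj₂)
open import Function using (case_of_)
open import Function.Bundles using (Equivalence; mk⇔)
open import Function.Construct.Composition using (_⇔-∘_)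
open import Function.Construct.Symmetry using (⇔-sym)
open import Relation.Binary using (Rel)
open import Relation.Nullary using (contradiction)
open import Relation.Binary.PropositionalEquality using (refl; sym; trans; cong; cong₂; subst; _≢_; module ≡-Reasoning)
open ≡-Reasoning

module _ {a ℓ} {A : Set a} {R : Rel A ℓ} where

  AllPairs-split : ∀ xs {x ys} → AllPairs R (xs ++ x ∷ ys) →
    All (λ y → R y x) xs × All (R x) ys × AllPairs R ys × AllPairs R (xs ++ ys)
  AllPairs-split []       (x<ys ∷ ys-sorted) = [] , x<ys , ys-sorted , ys-sorted
  AllPairs-split (y ∷ xs) (y<xs,x,ys ∷ sorted)
    with xs<x , x<ys , ys-sorted , xs,ys-sorted ← AllPairs-split xs sorted
       | y<xs , y<x ∷ y<ys ← All.++⁻ xs y<xs,x,ys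
    = y<x ∷ xs<x , x<ys , ys-sorted , All.++⁺ y<xs y<ys ∷ xs,ys-sorted

module _ {a} {A : Set a} where

  data PairSwap : List A → List A → Set a where
    []     : PairSwap [] []
    single : ∀ x → PairSwap [ x ] [ x ]
    keep   : ∀ {x y u s} → PairSwap u s → PairSwap (x ∷ y ∷ u) (x ∷ y ∷ s)
    swap   : ∀ {x y u s} → PairSwap u s → PairSwap (y ∷ x ∷ u) (x ∷ y ∷ s)

  PairSwap⇒↭ : ∀ {u s} → PairSwap u s → u ↭ s
  PairSwap⇒↭ []               = Perm.refl
  PairSwap⇒↭ (single x)       = Perm.refl
  PairSwap⇒↭ (keep {x} {y} p) = Perm.prep x (Perm.prep y (PairSwap⇒↭ p))
  PairSwap⇒↭ (swap {x} {y} p) = Perm.swap y x (PairSwap⇒↭ p)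

  PairSwap-∷ʳ : ∀ {u s} x → PairSwap u s → PairSwap (u ∷ʳ x) (s ∷ʳ x)
  PairSwap-∷ʳ x []         = single x
  PairSwap-∷ʳ x (single y) = keep []
  PairSwap-∷ʳ x (keep p)   = keep (PairSwap-∷ʳ x p)
  PairSwap-∷ʳ x (swap p)   = swap (PairSwap-∷ʳ x p)

  PairSwap-∷ʳ-swap : ∀ {u x y} s → evenIdx (length s) ≡ true →
    PairSwap u (s ∷ʳ y) → PairSwap (u ∷ʳ x) (s ++ x ∷ y ∷ [])
  PairSwap-∷ʳ-swap []          _    (single y) = swap []
  PairSwap-∷ʳ-swap (_ ∷ [])    ()
  PairSwap-∷ʳ-swap (_ ∷ _ ∷ s) even (keep p)   = keep (PairSwap-∷ʳ-swap s even p)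
  PairSwap-∷ʳ-swap (_ ∷ _ ∷ s) even (swap p)   = swap (PairSwap-∷ʳ-swap s even p)

  pairSwaps : List A → List (List A)
  pairSwaps []          = [ [] ]
  pairSwaps (x ∷ [])    = [ [ x ] ]
  pairSwaps (x ∷ y ∷ s) = map (λ u → x ∷ y ∷ u) (pairSwaps s) ++ map (λ u → y ∷ x ∷ u) (pairSwaps s)

  ∈-pairSwaps⁻ : ∀ {u} s → u ∈ pairSwaps s → PairSwap u s
  ∈-pairSwaps⁻ []          (here refl) = []
  ∈-pairSwaps⁻ (x ∷ [])    (here refl) = single x
  ∈-pairSwaps⁻ (x ∷ y ∷ s) u∈
    with ∈-++⁻ (map (λ u → x ∷ y ∷ u) (pairSwaps s)) u∈
  ... | inj₁ u∈kept    with t , t∈ , refl ← ∈-map⁻ (λ u → x ∷ y ∷ u) u∈kept    = keep (∈-pairSwaps⁻ s t∈)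
  ... | inj₂ u∈swapped with t , t∈ , refl ← ∈-map⁻ (λ u → y ∷ x ∷ u) u∈swapped = swap (∈-pairSwaps⁻ s t∈)

  ∈-pairSwaps⁺ : ∀ {u s} → PairSwap u s → u ∈ pairSwaps s
  ∈-pairSwaps⁺ []                       = here refl
  ∈-pairSwaps⁺ (single x)               = here refl
  ∈-pairSwaps⁺ (keep {x} {y} p)         = ∈-++⁺ˡ (∈-map⁺ (λ u → x ∷ y ∷ u) (∈-pairSwaps⁺ p))
  ∈-pairSwaps⁺ (swap {x} {y} {s = s} p) =
    ∈-++⁺ʳ (map (λ u → x ∷ y ∷ u) (pairSwaps s)) (∈-map⁺ (λ u → y ∷ x ∷ u) (∈-pairSwaps⁺ p))

  ∈-pairSwaps : ∀ {u s} → u ∈ pairSwaps s ⇔ PairSwap u s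
  ∈-pairSwaps {s = s} = mk⇔ (∈-pairSwaps⁻ s) ∈-pairSwaps⁺

  length-pairSwaps : ∀ s → length (pairSwaps s) ≡ 2 ^ (length s / 2)
  length-pairSwaps []          = refl
  length-pairSwaps (x ∷ [])    = refl
  length-pairSwaps (x ∷ y ∷ s) = begin
    length (map kept P ++ map swapped P)      ≡⟨ length-++ (map kept P) ⟩
    length (map kept P) + length (map swapped P)
                                              ≡⟨ cong₂ _+_ (length-map kept P) (length-map swapped P) ⟩
    length P + length P                       ≡⟨ cong (λ m → m + m) (length-pairSwaps s) ⟩
    2 ^ (length s / 2) + 2 ^ (length s / 2)   ≡⟨ cong (2 ^ (length s / 2) +_) (sym (+-identityʳ _)) ⟩
    2 ^ suc (length s / 2)
      ≡⟨ cong (2 ^_) (sym (m/n≡1+[m∸n]/n {length (x ∷ y ∷ s)} {2} (s≤s (s≤s z≤n)))) ⟩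
    2 ^ (length (x ∷ y ∷ s) / 2)              ∎
    where
    P : List (List A)
    P = pairSwaps s
    kept swapped : List A → List A
    kept    u = x ∷ y ∷ u
    swapped u = y ∷ x ∷ u

  pairSwaps-unique : ∀ {s} → Unique s → Unique (pairSwaps s)
  pairSwaps-unique {[]}        _ = [] ∷ []
  pairSwaps-unique {x ∷ []}    _ = [] ∷ []
  pairSwaps-unique {x ∷ y ∷ s} ((x≢y ∷ _) ∷ _ ∷ s-unique) =
    Unique.++⁺ (Unique.map⁺ tail-injective P-unique) (Unique.map⁺ tail-injective P-unique) disjoint
    where
    P-unique : Unique (pairSwaps s)
    P-unique = pairSwaps-unique s-unique
    tail-injective : ∀ {a b c d : A} {u v} → a ∷ b ∷ u ≡ c ∷ d ∷ v → u ≡ v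
    tail-injective eq = ∷-injectiveʳ (∷-injectiveʳ eq)
    disjoint : ∀ {v} →
      v ∈ map (λ u → x ∷ y ∷ u) (pairSwaps s) × v ∈ map (λ u → y ∷ x ∷ u) (pairSwaps s) → ⊥
    disjoint (v∈kept , v∈swapped)
      with _ , _ , refl ← ∈-map⁻ (λ u → x ∷ y ∷ u) v∈kept
         | _ , _ , eq   ← ∈-map⁻ (λ u → y ∷ x ∷ u) v∈swapped
      = x≢y (∷-injectiveˡ eq)

<ᵇ-true : ∀ {m n} → m < n → (m <ᵇ n) ≡ true
<ᵇ-true m<n = Equivalence.to T-≡ (<⇒<ᵇ m<n)

<ᵇ-false : ∀ {m n} → n ≤ m → (m <ᵇ n) ≡ false
<ᵇ-false {m} {n} n≤m with m <ᵇ n in eq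
... | false = refl
... | true  = contradiction (<ᵇ⇒< m n (subst T (sym eq) _)) (≤⇒≯ n≤m)

minAboveFrom-below : ∀ {a} i r → All (_< a) r → minAboveFrom a i r nothing ≡ nothing
minAboveFrom-below i []      []           = refl
minAboveFrom-below {a} i (x ∷ r) (x<a ∷ r<a) rewrite <ᵇ-false {a} {x} (<⇒≤ x<a) =
  minAboveFrom-below (suc i) r r<a

minAboveFrom-skip : ∀ {a} i r₁ r₂ → All (_< a) r₁ →
  minAboveFrom a i (r₁ ++ r₂) nothing ≡ minAboveFrom a (length r₁ + i) r₂ nothing
minAboveFrom-skip i []       r₂ []            = refl
minAboveFrom-skip {a} i (x ∷ r₁) r₂ (x<a ∷ r₁<a)
  rewrite <ᵇ-false {a} {x} (<⇒≤ x<a) =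
  trans (minAboveFrom-skip (suc i) r₁ r₂ r₁<a)
        (cong (λ k → minAboveFrom a k r₂ nothing) (+-suc (length r₁) i))

minAboveFrom-keep : ∀ {a b} i j r → a < b → All (b <_) r →
  minAboveFrom a j r (just (i , b)) ≡ just (i , b)
minAboveFrom-keep i j []      a<b []            = refl
minAboveFrom-keep {a} {b} i j (x ∷ r) a<b (b<x ∷ b<r)
  rewrite <ᵇ-true (<-trans a<b b<x) | <ᵇ-false {x} {b} (<⇒≤ b<x) = minAboveFrom-keep i (suc j) r a<b b<r

minAbove-sorted : ∀ {a b} r₁ r₂ → All (_< a) r₁ → a < b → All (b <_) r₂ →
  minAbove a (r₁ ++ b ∷ r₂) ≡ just (length r₁ , b)
minAbove-sorted {a} {b} r₁ r₂ r₁<a a<b b<r₂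
  rewrite minAboveFrom-skip {a} 0 r₁ (b ∷ r₂) r₁<a | +-identityʳ (length r₁) | <ᵇ-true a<b =
  minAboveFrom-keep (length r₁) _ r₂ a<b b<r₂

isLast : ∀ (r₁ : List ℕ) b r₂ → (suc (length r₁) ≡ᵇ length (r₁ ++ b ∷ r₂)) ≡ null r₂
isLast []       b []      = refl
isLast []       b (_ ∷ _) = refl
isLast (_ ∷ r₁) b r₂      = isLast r₁ b r₂

setAt-split : ∀ (r₁ : List ℕ) a b r₂ → setAt (length r₁) a (r₁ ++ b ∷ r₂) ≡ r₁ ++ a ∷ r₂
setAt-split []       a b r₂ = refl
setAt-split (x ∷ r₁) a b r₂ = cong (x ∷_) (setAt-split r₁ a b r₂)

rowStep-above : ∀ {a} r → All (_< a) r → rowStep a r ≡ (r ∷ʳ a , nothing)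
rowStep-above {a} r r<a rewrite minAboveFrom-below {a} 0 r r<a = refl

rowStep-swap : ∀ {a b} r → All (_< a) r → a < b → evenIdx (length r) ≡ true →
  rowStep a (r ∷ʳ b) ≡ (r ++ a ∷ b ∷ [] , nothing)
rowStep-swap {a} {b} r r<a a<b even
  rewrite minAbove-sorted r [] r<a a<b [] | even | isLast r b [] | setAt-split r a b []
  = cong (_, nothing) (++-assoc r [ a ] [ b ])

rowStep-bumps : ∀ {a b} r₁ r₂ → All (_< a) r₁ → a < b → All (b <_) r₂ →
  evenIdx (length r₁) ≡ false ⊎ null r₂ ≡ false → proj₂ (rowStep a (r₁ ++ b ∷ r₂)) ≢ nothing
rowStep-bumps {a} {b} r₁ r₂ r₁<a a<b b<r₂ bumpCondition
  rewrite minAbove-sorted r₁ r₂ r₁<a a<b b<r₂ with evenIdx (length r₁) | bumpCondition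
... | false | _         = λ ()
... | true  | inj₁ ()
... | true  | inj₂ inner rewrite isLast r₁ b r₂ | inner = λ ()

rowStep-stays-inv : ∀ {a r} r₁ r₂ → All (_< a) r₁ → All (a <_) r₂ → AllPairs _<_ r₂ →
  rowStep a (r₁ ++ r₂) ≡ (r , nothing) →
  (r₂ ≡ [] × r ≡ r₁ ∷ʳ a) ⊎ (∃ λ b → r₂ ≡ [ b ] × evenIdx (length r₁) ≡ true × r ≡ r₁ ++ a ∷ b ∷ [])
rowStep-stays-inv r₁ [] r₁<a _ _ stays rewrite ++-identityʳ r₁ =
  inj₁ (refl , cong proj₁ (trans (sym stays) (rowStep-above r₁ r₁<a)))
rowStep-stays-inv r₁ (b ∷ r₂) r₁<a (a<b ∷ _) (b<r₂ ∷ _) stays with evenIdx (length r₁) in even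
... | false = contradiction (cong proj₂ stays) (rowStep-bumps r₁ r₂ r₁<a a<b b<r₂ (inj₁ even))
rowStep-stays-inv r₁ (b ∷ []) r₁<a (a<b ∷ _) _ stays | true =
  inj₂ (b , refl , refl , cong proj₁ (trans (sym stays) (rowStep-swap r₁ r₁<a a<b even)))
rowStep-stays-inv r₁ (b ∷ c ∷ r₂) r₁<a (a<b ∷ _) (b<r₂ ∷ _) stays | true =
  contradiction (cong proj₂ stays) (rowStep-bumps r₁ (c ∷ r₂) r₁<a a<b b<r₂ (inj₂ refl))

insert-stays : ∀ a r {r′} rs → rowStep a r ≡ (r′ , nothing) → insert a (r ∷ rs) ≡ r′ ∷ rs
insert-stays a r rs stays rewrite stays = refl

insert-nonempty : ∀ a P → insert a P ≢ []
insert-nonempty a []       ()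
insert-nonempty a (r ∷ rs) with rowStep a r
... | _ , nothing = λ ()
... | _ , just _  = λ ()

insert-singleton-inv : ∀ {a r′} P → P ≢ [] → insert a P ≡ [ r′ ] →
  ∃ λ r → P ≡ [ r ] × rowStep a r ≡ (r′ , nothing)
insert-singleton-inv []       P≢[] _ = contradiction refl P≢[]
insert-singleton-inv {a} (r ∷ rs) _ eq with rowStep a r in stays
... | _ , nothing with refl ← eq = r , refl , stays
... | _ , just b = contradiction (∷-injectiveʳ eq) (insert-nonempty b rs)

insert-increasingPair : ∀ {x y} r → All (_< x) r → x < y → insert y (insert x [ r ]) ≡ [ r ++ x ∷ y ∷ [] ]
insert-increasingPair {x} {y} r r<x x<y = begin
  insert y (insert x [ r ])  ≡⟨ cong (insert y) (insert-stays x r [] (rowStep-above r r<x)) ⟩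
  insert y [ r ∷ʳ x ]        ≡⟨ insert-stays y (r ∷ʳ x) [] (rowStep-above (r ∷ʳ x) (All.∷ʳ⁺ r<y x<y)) ⟩
  [ r ∷ʳ x ∷ʳ y ]            ≡⟨ cong [_] (++-assoc r [ x ] [ y ]) ⟩
  [ r ++ x ∷ y ∷ [] ]        ∎
  where
  r<y : All (_< y) r
  r<y = All.map (λ z<x → <-trans z<x x<y) r<x

insert-decreasingPair : ∀ {x y} r → All (_< x) r → x < y → evenIdx (length r) ≡ true →
  insert x (insert y [ r ]) ≡ [ r ++ x ∷ y ∷ [] ]
insert-decreasingPair {x} {y} r r<x x<y even = begin
  insert x (insert y [ r ])  ≡⟨ cong (insert x) (insert-stays y r [] (rowStep-above r r<y)) ⟩
  insert x [ r ∷ʳ y ]        ≡⟨ insert-stays x (r ∷ʳ y) [] (rowStep-swap r r<x x<y even) ⟩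
  [ r ++ x ∷ y ∷ [] ]        ∎
  where
  r<y : All (_< y) r
  r<y = All.map (λ z<x → <-trans z<x x<y) r<x

insertAll : Tableau → List ℕ → Tableau
insertAll = foldl (λ P a → insert a P)

-- insertionTableau (x ∷ xs) is definitionally tableau (x ∷ xs): inserting x into
-- the empty row gives [ [ x ] ].
tableau : List ℕ → Tableau
tableau = insertAll [ [] ]

length≡1 : ∀ (P : Tableau) → length P ≡ 1 → ∃ λ r → P ≡ [ r ]
length≡1 (r ∷ []) _ = r , refl

tableau-∷ʳ : ∀ u a → tableau (u ∷ʳ a) ≡ insert a (tableau u)
tableau-∷ʳ u a = foldl-∷ʳ (λ P a → insert a P) [ [] ] a u

tableau-nonempty : ∀ w → tableau w ≢ []
tableau-nonempty w with reverseView w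
... | []          = λ ()
... | u ∶ _ ∶ʳ a rewrite tableau-∷ʳ u a = insert-nonempty a (tableau u)

evenIdx-++-pair : ∀ (r : List ℕ) x y → evenIdx (length (r ++ x ∷ y ∷ [])) ≡ evenIdx (length r)
evenIdx-++-pair []           x y = refl
evenIdx-++-pair (_ ∷ [])     x y = refl
evenIdx-++-pair (_ ∷ _ ∷ r)  x y = evenIdx-++-pair r x y

sorted-pair-split : ∀ r {x y s} → AllPairs _<_ (r ++ x ∷ y ∷ s) →
  All (_< x) r × x < y × AllPairs _<_ ((r ++ x ∷ y ∷ []) ++ s)
sorted-pair-split r {x} {y} {s} sorted with r<x , x<y ∷ _ , _ ← AllPairs-split r sorted =
  r<x , x<y , subst (AllPairs _<_) (sym (++-assoc r (x ∷ y ∷ []) s)) sorted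

insertAll-PairSwap : ∀ {u s} r → PairSwap u s → AllPairs _<_ (r ++ s) → evenIdx (length r) ≡ true →
  insertAll [ r ] u ≡ [ r ++ s ]
insertAll-PairSwap r []         _      _ = cong [_] (sym (++-identityʳ r))
insertAll-PairSwap r (single x) sorted _ = insert-stays x r [] (rowStep-above r (proj₁ (AllPairs-split r sorted)))
insertAll-PairSwap r (keep {x} {y} {u} {s} p) sorted even
  with r<x , x<y , sorted′ ← sorted-pair-split r sorted = begin
  insertAll (insert y (insert x [ r ])) u  ≡⟨ cong (λ P → insertAll P u) (insert-increasingPair r r<x x<y) ⟩
  insertAll [ r ++ x ∷ y ∷ [] ] u          ≡⟨ insertAll-PairSwap _ p sorted′ (trans (evenIdx-++-pair r x y) even) ⟩
  [ (r ++ x ∷ y ∷ []) ++ s ]               ≡⟨ cong [_] (++-assoc r (x ∷ y ∷ []) s) ⟩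
  [ r ++ x ∷ y ∷ s ]                       ∎
insertAll-PairSwap r (swap {x} {y} {u} {s} p) sorted even
  with r<x , x<y , sorted′ ← sorted-pair-split r sorted = begin
  insertAll (insert x (insert y [ r ])) u  ≡⟨ cong (λ P → insertAll P u) (insert-decreasingPair r r<x x<y even) ⟩
  insertAll [ r ++ x ∷ y ∷ [] ] u          ≡⟨ insertAll-PairSwap _ p sorted′ (trans (evenIdx-++-pair r x y) even) ⟩
  [ (r ++ x ∷ y ∷ []) ++ s ]               ≡⟨ cong [_] (++-assoc r (x ∷ y ∷ []) s) ⟩
  [ r ++ x ∷ y ∷ s ]                       ∎

tableau-PairSwap : ∀ {u s} → AllPairs _<_ s → PairSwap u s → tableau u ≡ [ s ]
tableau-PairSwap sorted p = insertAll-PairSwap [] p sorted refl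

singleRow⇒PairSwap : ∀ {w} → Reverse w → ∀ {s} → AllPairs _<_ s → w ↭ s → length (tableau w) ≡ 1 →
  PairSwap w s × tableau w ≡ [ s ]
singleRow⇒PairSwap [] _ w↭s _ with refl ← ↭-empty-inv (Perm.↭-sym w↭s) = [] , refl
singleRow⇒PairSwap (u ∶ u-view ∶ʳ a) sorted w↭s oneRow
  with s₁ , s₂ , refl ← ∈-∃++ (∈-resp-↭ w↭s (∈-++⁺ʳ u (here refl)))
  with s₁<a , a<s₂ , s₂-sorted , s₁s₂-sorted ← AllPairs-split s₁ sorted
  with r , tableau-w≡r ← length≡1 (tableau (u ∷ʳ a)) oneRow
  with r₀ , tableau-u≡r₀ , stays ← insert-singleton-inv (tableau u) (tableau-nonempty u)
                                      (trans (sym (tableau-∷ʳ u a)) tableau-w≡r)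
  with u-swaps , tableau-u≡s₁s₂ ← singleRow⇒PairSwap u-view s₁s₂-sorted
                                      (subst (_↭ s₁ ++ s₂) (++-identityʳ u) (drop-mid u s₁ w↭s))
                                      (cong length tableau-u≡r₀)
  with refl ← ∷-injectiveˡ (trans (sym tableau-u≡r₀) tableau-u≡s₁s₂)
  with rowStep-stays-inv s₁ s₂ s₁<a a<s₂ s₂-sorted stays
... | inj₁ (refl , refl) = PairSwap-∷ʳ a (subst (PairSwap u) (++-identityʳ s₁) u-swaps) , tableau-w≡r
... | inj₂ (b , refl , even , refl) = PairSwap-∷ʳ-swap s₁ even u-swaps , tableau-w≡r

singleRow⇔PairSwap : ∀ {s} → AllPairs _<_ s → ∀ w → (w ↭ s × length (tableau w) ≡ 1) ⇔ PairSwap w s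
singleRow⇔PairSwap sorted w = mk⇔
  (λ (w↭s , oneRow) → proj₁ (singleRow⇒PairSwap (reverseView w) sorted w↭s oneRow))
  (λ p → PairSwap⇒↭ p , cong length (tableau-PairSwap sorted p))

mainTheorem7 : ∀ (n : ℕ) → n ≥ 1 →
    Σ (List (List ℕ)) λ L →
      Unique L
      × (∀ (π : List ℕ) → (π ∈ L) ⇔ ((π ↭ oneToN n) × (length (insertionTableau π) ≡ 1)))
      × (length L ≡ 2 ^ (n / 2))
mainTheorem7 n@(suc _) _ =
  pairSwaps s , pairSwaps-unique (AllPairs.map <⇒≢ s-sorted) , characterisation , count
  where
  s : List ℕ
  s = oneToN n
  s-sorted : AllPairs _<_ s
  s-sorted = AllPairs.applyUpTo⁺₁ suc n (λ i<j _ → s≤s i<j)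
  characterisation : ∀ π → π ∈ pairSwaps s ⇔ (π ↭ s × length (insertionTableau π) ≡ 1)
  characterisation []        = mk⇔ (λ π∈ → case ∈-pairSwaps⁻ s π∈ of λ ()) (λ { (_ , ()) })
  characterisation π@(_ ∷ _) = ⇔-sym (singleRow⇔PairSwap s-sorted π) ⇔-∘ ∈-pairSwaps
  count : length (pairSwaps s) ≡ 2 ^ (n / 2)
  count = trans (length-pairSwaps s) (cong (λ m → 2 ^ (m / 2)) (length-applyUpTo suc n))
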